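{- Let $k\in\mathbb{N}$ and $0\le i<r$. Then: (i) $\mathbf{n}_i\in\mathcal{W}(k)$ if and only if $k\not\equiv r-i\pmod r$; (ii) $\sigma^{(i)}=\{\mathbf{n}_j: 0\le j<r,\ j\ne i\}$ is an $(r-2)$-simplex of $\mathcal{W}(k)$ (i.e. all its vertices lie in $\mathcal{W}(k)$) if and only if $k\equiv r-i\pmod r$.
   Context: $\mathbb{F}=\mathbb{F}_q$, $A=\mathbb{F}[T]$, $K_\infty=\mathbb{F}((T^{ -1}))$ with $|T|=q$, $r\ge2$, $V=K_\infty^r$ with standard basis $e_1,\dots,e_r$. $\mathcal{W}(\mathbb{Q})=\{\mathbf{x}\in\mathbb{Q}^r: x_1\ge\dots\ge x_{r-1}\ge x_r=0\}$ (rational points of the standard Weyl chamber in the Bruhat–Tits building of $\mathrm{PGL}(r,K_\infty)$). Put $\mathbf{n}_0=\mathbf{0}$ and, for $1\le i<r$, $\mathbf{n}_i=(1,\dots,1,0,\dots,0)$ with $i$ ones and $r-i$ zeros; $\{\mathbf{n}_0,\dots,\mathbf{n}_{r-1}\}$ is the vertex set of the standard $(r-1)$-simplex. For $\mathbf{x}\in\mathcal{W}(\mathbb{Q})$ let $\nu_{\mathbf{x}}(\sum v_ie_i)=\max_i|v_i|q^{x_i}$ on $V$; $\mathbf{x}$ is $k$-inseparable if, for an $\mathbb{F}$-successive minimum basis $(\mu_1,\mu_2,\dots)$ of $(\bigoplus_iAe_i,\nu_{\mathbf{x}})$ (each $\mu_j$ of minimal norm outside $\sum_{l<j}\mathbb{F}\mu_l$),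 $\nu_{\mathbf{x}}(\mu_k)=\nu_{\mathbf{x}}(\mu_{k+1})$ (independent of the choice). Equivalently, the lattice $\Lambda_\omega=\sum A\omega_i$ is $k$-inseparable for $\omega$ in the building-map fibre over $\mathbf{x}$; this set equals the image under the building map of the zeros of the para-Eisenstein series $\alpha_k$ in the fundamental domain. $\mathcal{W}(k)$ is the set of $k$-inseparable points of $\mathcal{W}(\mathbb{Q})$, regarded as a full subcomplex (simplices = simplices of the building with all vertices in $\mathcal{W}(k)$). -}

module Defs where

open import Level using (Level; _⊔_) renaming (suc to lsuc)
open import Algebra.Bundles using (CommutativeRing)
open import Data.Nat as ℕ using (ℕ; zero; suc; pred; _<ᵇ_)
open import Data.Bool using (if_then_else_)
open import Data.Fin as Fin using (Fin; toℕ; fromℕ)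
open import Data.List using (List; []; _∷_)
open import Data.List.Membership.Setoid using ()
open import Data.List.Relation.Unary.Any using (Any)
open import Data.Maybe using (Maybe; just; nothing)
open import Data.Product using (Σ; ∃; _×_; _,_)
open import Data.Integer as ℤ using (ℤ)
open import Data.Rational as ℚ using (ℚ; 0ℚ; 1ℚ)
open import Relation.Nullary using (¬_; Dec; yes; no)
open import Relation.Binary.PropositionalEquality using (_≡_)

record FiniteField (c ℓ : Level) : Set (lsuc (c ⊔ ℓ)) where
  field
    commRing : CommutativeRing c ℓ
  open CommutativeRing commRing public
  field
    _≟_      : (a b : Carrier) → Dec (a ≈ b)
    1≉0      : ¬ (1# ≈ 0#)
    inverse  : (a : Carrier) → ¬ (a ≈ 0#) → ∃ λ b → (a * b) ≈ 1#
    elements : List Carrier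
    complete : (a : Carrier) → Any (λ b → a ≈ b) elements

module _ {c ℓ : Level} (F : FiniteField c ℓ) where
  open FiniteField F

  -- A = F[T]: a polynomial is its list of coefficients, constant term first.
  Poly : Set c
  Poly = List Carrier

  coeff : Poly → ℕ → Carrier
  coeff []       n       = 0#
  coeff (a ∷ as) zero    = a
  coeff (a ∷ as) (suc n) = coeff as n

  -- degree; nothing stands for the zero polynomial (degree -∞)
  deg : Poly → Maybe ℕ
  deg [] = nothing
  deg (a ∷ as) with deg as
  ... | just d  = just (suc d)
  ... | nothing with a ≟ 0#
  ...   | yes _ = nothing
  ...   | no  _ = just 0

  AVec : ℕ → Set c
  AVec r = Fin r → Poly

  sumF : ℕ → (ℕ → Carrier) → Carrier
  sumF zero    f = 0#
  sumF (suc j) f = sumF j f + f j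

  InSpan : {r : ℕ} → ℕ → (ℕ → AVec r) → AVec r → Set (c ⊔ ℓ)
  InSpan j μ w = ∃ λ (a : ℕ → Carrier) →
    ∀ i n → coeff (w i) n ≈ sumF j (λ l → a l * coeff (μ l i) n)

-- log_q of the norm  ν_x(v) = max_i |v_i| q^{x_i},  i.e.
--   log_q ν_x(v) = max_i (deg v_i + x_i),  with nothing = log_q 0 = -∞.

maxM : Maybe ℚ → Maybe ℚ → Maybe ℚ
maxM nothing  b        = b
maxM (just a) nothing  = just a
maxM (just a) (just b) = just (a ℚ.⊔ b)

data _≤M_ : Maybe ℚ → Maybe ℚ → Set where
  nothing≤ : ∀ {b} → nothing ≤M b
  just≤    : ∀ {a b} → a ℚ.≤ b → just a ≤M just b

ℕtoℚ : ℕ → ℚ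
ℕtoℚ n = (ℤ.+ n) ℚ./ 1

module _ {c ℓ : Level} (F : FiniteField c ℓ) where
  open FiniteField F

  termM : Maybe ℕ → ℚ → Maybe ℚ
  termM nothing  q = nothing
  termM (just d) q = just (ℕtoℚ d ℚ.+ q)

  maxFin : (r : ℕ) → (Fin r → Maybe ℚ) → Maybe ℚ
  maxFin zero    f = nothing
  maxFin (suc r) f = maxM (f Fin.zero) (maxFin r (λ i → f (Fin.suc i)))

  logNorm : {r : ℕ} → (Fin r → ℚ) → AVec F r → Maybe ℚ
  logNorm {r} x v = maxFin r (λ i → termM (deg F (v i)) (x i))

  -- μ 0, μ 1, μ 2, … is an F-successive minimum basis (μ_1, μ_2, … in
  -- the paper): each μ_j has minimal norm outside Σ_{l<j} F μ_l.
  IsSuccMinBasis : {r : ℕ} → (Fin r → ℚ) → (ℕ → AVec F r) → Set (c ⊔ ℓ)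
  IsSuccMinBasis x μ = ∀ j →
    (¬ InSpan F j μ (μ j)) ×
    (∀ w → ¬ InSpan F j μ w → logNorm x (μ j) ≤M logNorm x w)

  -- x is k-inseparable (k ≥ 1): ν_x(μ_k) = ν_x(μ_{k+1}) for a successive
  -- minimum basis (paper indexing μ_1, μ_2, … ↦ μ 0, μ 1, …).
  Inseparable : {r : ℕ} → ℕ → (Fin r → ℚ) → Set (c ⊔ ℓ)
  Inseparable k x = ∃ λ μ → IsSuccMinBasis x μ ×
    (logNorm x (μ (pred k)) ≡ logNorm x (μ k))

InChamber : (r : ℕ) → (Fin r → ℚ) → Set
InChamber zero    x = Data.Unit.⊤ where import Data.Unit
InChamber (suc zero) x = x Fin.zero ≡ 0ℚ
InChamber (suc (suc r)) x =
  (x (Fin.suc Fin.zero) ℚ.≤ x Fin.zero) × InChamber (suc r) (λ i → x (Fin.suc i))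

module _ {c ℓ : Level} (F : FiniteField c ℓ) where
  InW : (r k : ℕ) → (Fin r → ℚ) → Set (c ⊔ ℓ)
  InW r k x = Lift' (InChamber r x) × Inseparable F k x
    where
    Lift' : Set → Set (c ⊔ ℓ)
    Lift' A = Level.Lift (c ⊔ ℓ) A

vertex : (r : ℕ) → ℕ → Fin r → ℚ
vertex r i j = if toℕ j <ᵇ i then 1ℚ else 0ℚ

module Submission where

-- At the vertex n_s the norm is ν(Σ vₐ eₐ) = maxₐ |vₐ| q^[a < s], so the monomials T^n eₐ, listed by
-- their log-norm n + [a < s] and then by a, form a successive minimum basis whose j-th member
-- (counting from 0) has log-norm ⌊(j + s)/r⌋. Every successive minimum basis μ has these norms: were
-- ν(μ_j) smaller, μ_0, …, μ_j would lie in the span of the first j monomials; were it larger, the first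
-- j + 1 monomials would lie in the span of μ_0, …, μ_{j-1}; either contradicts the exchange lemma.
-- Hence n_s is k-inseparable iff ⌊(k - 1 + s)/r⌋ = ⌊(k + s)/r⌋, i.e. iff k ≢ r - s (mod r). This is
-- part (i); part (ii) follows because exactly one s < r has k ≡ r - s (mod r).

open import Defs
open import Level using (Level; lift)
import Level
open import Data.Nat as ℕ
  using (ℕ; zero; suc; pred; _∸_; _⊔_; _%_; _≤_; _<_; _≤?_; _<?_; _<ᵇ_; z≤n; s≤s; z<s; NonZero)
open import Data.Nat.Properties
  using ( ≤-refl; ≤-reflexive; ≤-trans; ≤-antisym; ≤-total; ≤-pred; <-trans; <-≤-trans; <-irrefl
        ; <⇒≤; <⇒≱; ≮⇒≥; ≰⇒>; ≤∧≢⇒<; m≤n⇒m≤1+n; m<n⇒m<1+n; suc-injective; +-cancelʳ-≤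
        ; m≤m⊔n; m≤n⊔m; ⊔-identityʳ; m≤n⇒m⊔n≡n; m≥n⇒m⊔n≡m )
  renaming (_≟_ to _≟ℕ_)
open import Data.Nat.DivMod using (m%n<n)
import Data.Nat.Coprimality as Coprime
open import Data.Integer as ℤ using (+≤+)
import Data.Integer.Properties as ℤₚ
open import Data.Rational as ℚ using (ℚ; mkℚ; *≤*)
import Data.Rational.Properties as ℚₚ
open import Data.Fin as Fin using (Fin; toℕ; fromℕ<)
import Data.Fin.Properties as Finₚ
open import Data.Bool using (true; false; if_then_else_; T)
open import Data.Unit using (tt)
open import Data.List using ([]; _∷_)
open import Data.Maybe using (Maybe; just; nothing)
open import Data.Product using (∃; _×_; _,_; proj₁; proj₂)
open import Data.Sum using (_⊎_; inj₁; inj₂)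
open import Data.Empty using (⊥-elim)
open import Function.Base using (_∘_)
open import Function.Bundles using (_⇔_; mk⇔; Equivalence)
import Function.Properties.Equivalence as ⇔
open import Relation.Nullary using (¬_; yes; no)
open import Relation.Binary.PropositionalEquality as ≡ using (_≡_; _≢_)

¬¬-∀≤ : ∀ {p} {P : ℕ → Set p} m → (∀ l → l ≤ m → ¬ ¬ P l) → ¬ ¬ (∀ l → l ≤ m → P l)
¬¬-∀≤ zero ¬¬P ¬all = ¬¬P 0 z≤n λ p₀ → ¬all λ { zero _ → p₀ }
¬¬-∀≤ {P = P} (suc m) ¬¬P ¬all = ¬¬P 0 z≤n λ p₀ →
  ¬¬-∀≤ {P = λ l → P (suc l)} m (λ l l≤m → ¬¬P (suc l) (s≤s l≤m)) λ rest →
    ¬all λ { zero _ → p₀ ; (suc l) (s≤s l≤m) → rest l l≤m }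

everywhereBut⇔ : ∀ {n p q} {P : Fin n → Set p} {Q : Fin n → Set q} →
  (∀ j → P j ⇔ (¬ Q j)) → ∃ Q → (∀ {i j} → Q i → Q j → i ≡ j) →
  ∀ i → (∀ j → j ≢ i → P j) ⇔ Q i
everywhereBut⇔ {P = P} {Q} P⇔¬Q (i₀ , Qi₀) Q-unique i = mk⇔ to from
  where
  to : (∀ j → j ≢ i → P j) → Q i
  to P-elsewhere with i₀ Fin.≟ i
  ... | yes ≡.refl = Qi₀
  ... | no  i₀≢i   = ⊥-elim (Equivalence.to (P⇔¬Q i₀) (P-elsewhere i₀ i₀≢i) Qi₀)
  from : Q i → ∀ j → j ≢ i → P j
  from Qi j j≢i = Equivalence.from (P⇔¬Q j) λ Qj → j≢i (Q-unique Qj Qi)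

module Modulo (r : ℕ) .{{_ : NonZero r}} where
  open import Data.Nat using (_+_; _*_; _/_; >-nonZero⁻¹)
  open import Data.Nat.Properties
  open import Data.Nat.DivMod
  open ≡
  open ≡-Reasoning

  [m+kr]/r≡k : ∀ {m} k → m < r → (m + k * r) / r ≡ k
  [m+kr]/r≡k {m} k m<r = begin
    (m + k * r) / r     ≡⟨ +-distrib-/ m (k * r) (subst (_< r) (sym m%r+kr%r≡m) m<r) ⟩
    m / r + k * r / r   ≡⟨ cong₂ _+_ (m<n⇒m/n≡0 m<r) (m*n/n≡m k r) ⟩
    k                   ∎
    where
    m%r+kr%r≡m : m % r + k * r % r ≡ m
    m%r+kr%r≡m = trans (cong₂ _+_ (m<n⇒m%n≡m m<r) (m*n%n≡0 k r)) (+-identityʳ m)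

  [m+kr]%r≡m : ∀ {m} k → m < r → (m + k * r) % r ≡ m
  [m+kr]%r≡m {m} k m<r = trans ([m+kn]%n≡m%n m k r) (m<n⇒m%n≡m m<r)

  m/r≡[1+m]/r⇔ : ∀ m → (m / r ≡ suc m / r) ⇔ (suc m % r ≢ 0)
  m/r≡[1+m]/r⇔ m with suc (m % r) <? r
  ... | yes 1+m%r<r = mk⇔ (λ _ → 1+n≢0 ∘ trans (sym 1+m%r≡)) (λ _ → sym 1+m/r≡)
    where
    split : suc m ≡ suc (m % r) + m / r * r
    split = cong suc (m≡m%n+[m/n]*n m r)
    1+m%r≡ : suc m % r ≡ suc (m % r)
    1+m%r≡ = trans (cong (_% r) split) ([m+kr]%r≡m (m / r) 1+m%r<r)
    1+m/r≡ : suc m / r ≡ m / r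
    1+m/r≡ = trans (cong (_/ r) split) ([m+kr]/r≡k (m / r) 1+m%r<r)
  ... | no 1+m%r≮r =
    mk⇔ (λ m/r≡ → ⊥-elim (1+n≢n (trans (sym 1+m/r≡) (sym m/r≡)))) (λ 1+m%r≢0 → ⊥-elim (1+m%r≢0 1+m%r≡0))
    where
    split : suc m ≡ 0 + suc (m / r) * r
    split = trans (cong suc (m≡m%n+[m/n]*n m r))
                  (cong (_+ m / r * r) (≤-antisym (m%n<n m r) (≮⇒≥ 1+m%r≮r)))
    1+m%r≡0 : suc m % r ≡ 0
    1+m%r≡0 = trans (cong (_% r) split) ([m+kr]%r≡m (suc (m / r)) (>-nonZero⁻¹ r))
    1+m/r≡ : suc m / r ≡ suc (m / r)
    1+m/r≡ = trans (cong (_/ r) split) ([m+kr]/r≡k (suc (m / r)) (>-nonZero⁻¹ r))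

  [m+n]%r≡0⇔ : ∀ m {n} → n ≤ r → (m + n) % r ≡ 0 ⇔ m % r ≡ (r ∸ n) % r
  [m+n]%r≡0⇔ m {n} n≤r = mk⇔ to from
    where
    to : (m + n) % r ≡ 0 → m % r ≡ (r ∸ n) % r
    to m+n≡0 = begin
      m % r                               ≡⟨ [m+n]%n≡m%n m r ⟨
      (m + r) % r                         ≡⟨ cong (λ z → (m + z) % r) (m+[n∸m]≡n n≤r) ⟨
      (m + (n + (r ∸ n))) % r             ≡⟨ cong (_% r) (+-assoc m n (r ∸ n)) ⟨
      (m + n + (r ∸ n)) % r               ≡⟨ %-distribˡ-+ (m + n) (r ∸ n) r ⟩
      ((m + n) % r + (r ∸ n) % r) % r     ≡⟨ cong (λ z → (z + (r ∸ n) % r) % r) m+n≡0 ⟩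
      (r ∸ n) % r % r                     ≡⟨ m%n%n≡m%n (r ∸ n) r ⟩
      (r ∸ n) % r                         ∎
    from : m % r ≡ (r ∸ n) % r → (m + n) % r ≡ 0
    from m≡r∸n = begin
      (m + n) % r                         ≡⟨ %-distribˡ-+ m n r ⟩
      (m % r + n % r) % r                 ≡⟨ cong (λ z → (z + n % r) % r) m≡r∸n ⟩
      ((r ∸ n) % r + n % r) % r           ≡⟨ %-distribˡ-+ (r ∸ n) n r ⟨
      (r ∸ n + n) % r                     ≡⟨ cong (_% r) (m∸n+n≡m n≤r) ⟩
      r % r                               ≡⟨ n%n≡0 r ⟩
      0                                   ∎

  [m+n]/r≡[1+m+n]/r⇔ : ∀ m {n} → n ≤ r →
    ((m + n) / r ≡ (suc m + n) / r) ⇔ (¬ (suc m % r ≡ (r ∸ n) % r))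
  [m+n]/r≡[1+m+n]/r⇔ m {n} n≤r = mk⇔
    (λ /≡ → Equivalence.to (m/r≡[1+m]/r⇔ (m + n)) /≡ ∘ Equivalence.from ([m+n]%r≡0⇔ (suc m) n≤r))
    (λ %≢ → Equivalence.from (m/r≡[1+m]/r⇔ (m + n)) (%≢ ∘ Equivalence.to ([m+n]%r≡0⇔ (suc m) n≤r)))

  [m+i]%r≡0-unique-≤ : ∀ m {i j} → i ≤ j → j < r → (m + i) % r ≡ 0 → (m + j) % r ≡ 0 → i ≡ j
  [m+i]%r≡0-unique-≤ m {i} {j} i≤j j<r m+i≡0 m+j≡0 = ≤-antisym i≤j (m∸n≡0⇒m≤n (begin
    j ∸ i                               ≡⟨ m<n⇒m%n≡m (≤-<-trans (m∸n≤m j i) j<r) ⟨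
    (j ∸ i) % r                         ≡⟨ m%n%n≡m%n (j ∸ i) r ⟨
    (0 + (j ∸ i) % r) % r               ≡⟨ cong (λ z → (z + (j ∸ i) % r) % r) m+i≡0 ⟨
    ((m + i) % r + (j ∸ i) % r) % r     ≡⟨ %-distribˡ-+ (m + i) (j ∸ i) r ⟨
    (m + i + (j ∸ i)) % r               ≡⟨ cong (_% r) (+-assoc m i (j ∸ i)) ⟩
    (m + (i + (j ∸ i))) % r             ≡⟨ cong (λ z → (m + z) % r) (m+[n∸m]≡n i≤j) ⟩
    (m + j) % r                         ≡⟨ m+j≡0 ⟩
    0                                   ∎))

  [m+i]%r≡0-unique : ∀ m {i j} → i < r → j < r → (m + i) % r ≡ 0 → (m + j) % r ≡ 0 → i ≡ j
  [m+i]%r≡0-unique m {i} {j} i<r j<r m+i≡0 m+j≡0 with ≤-total i j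
  ... | inj₁ i≤j = [m+i]%r≡0-unique-≤ m i≤j j<r m+i≡0 m+j≡0
  ... | inj₂ j≤i = sym ([m+i]%r≡0-unique-≤ m j≤i i<r m+j≡0 m+i≡0)

  [m+[r∸m%r]%r]%r≡0 : ∀ m → (m + (r ∸ m % r) % r) % r ≡ 0
  [m+[r∸m%r]%r]%r≡0 m = begin
    (m + j) % r                         ≡⟨ %-distribˡ-+ m j r ⟩
    (m % r + j % r) % r                 ≡⟨ cong (λ z → (z + j % r) % r) (m%n%n≡m%n m r) ⟨
    (m % r % r + j % r) % r             ≡⟨ cong (λ z → (m % r % r + z) % r) (m%n%n≡m%n (r ∸ m % r) r) ⟩
    (m % r % r + (r ∸ m % r) % r) % r   ≡⟨ %-distribˡ-+ (m % r) (r ∸ m % r) r ⟨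
    (m % r + (r ∸ m % r)) % r           ≡⟨ cong (_% r) (m+[n∸m]≡n (m%n≤n m r)) ⟩
    r % r                               ≡⟨ n%n≡0 r ⟩
    0                                   ∎
    where j = (r ∸ m % r) % r

ℕtoℚ≡mkℚ : ∀ n → ℕtoℚ n ≡ mkℚ (ℤ.+ n) 0 (Coprime.sym (Coprime.1-coprimeTo n))
ℕtoℚ≡mkℚ n = ℚₚ.normalize-coprime _

ℕtoℚ-+ : ∀ m n → ℕtoℚ m ℚ.+ ℕtoℚ n ≡ ℕtoℚ (m ℕ.+ n)
ℕtoℚ-+ m n rewrite ℕtoℚ≡mkℚ m | ℕtoℚ≡mkℚ n =
  ≡.cong₂ (λ i j → (i ℤ.+ j) ℚ./ 1) (ℤₚ.*-identityʳ (ℤ.+ m)) (ℤₚ.*-identityʳ (ℤ.+ n))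

ℕtoℚ-mono-≤ : ∀ {m n} → m ≤ n → ℕtoℚ m ℚ.≤ ℕtoℚ n
ℕtoℚ-mono-≤ {m} {n} m≤n rewrite ℕtoℚ≡mkℚ m | ℕtoℚ≡mkℚ n =
  *≤* (≡.subst₂ ℤ._≤_ (≡.sym (ℤₚ.*-identityʳ (ℤ.+ m))) (≡.sym (ℤₚ.*-identityʳ (ℤ.+ n))) (+≤+ m≤n))

ℕtoℚ-cancel-≤ : ∀ {m n} → ℕtoℚ m ℚ.≤ ℕtoℚ n → m ≤ n
ℕtoℚ-cancel-≤ {m} {n} le rewrite ℕtoℚ≡mkℚ m | ℕtoℚ≡mkℚ n with le
... | *≤* h with ≡.subst₂ ℤ._≤_ (ℤₚ.*-identityʳ (ℤ.+ m)) (ℤₚ.*-identityʳ (ℤ.+ n)) h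
... | +≤+ m≤n = m≤n

ℕtoℚ-⊔ : ∀ m n → ℕtoℚ m ℚ.⊔ ℕtoℚ n ≡ ℕtoℚ (m ⊔ n)
ℕtoℚ-⊔ m n with ≤-total m n
... | inj₁ m≤n = ≡.trans (ℚₚ.p≤q⇒p⊔q≡q (ℕtoℚ-mono-≤ m≤n)) (≡.cong ℕtoℚ (≡.sym (m≤n⇒m⊔n≡n m≤n)))
... | inj₂ n≤m = ≡.trans (ℚₚ.p≥q⇒p⊔q≡p (ℕtoℚ-mono-≤ n≤m)) (≡.cong ℕtoℚ (≡.sym (m≥n⇒m⊔n≡m n≤m)))

-- Log-norms are handled in ℕ: size 0 encodes log 0 = -∞ and size suc d encodes d.
fromSize : ℕ → Maybe ℚ
fromSize zero    = nothing
fromSize (suc d) = just (ℕtoℚ d)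

fromSize-⊔ : ∀ m n → maxM (fromSize m) (fromSize n) ≡ fromSize (m ⊔ n)
fromSize-⊔ zero    n       = ≡.refl
fromSize-⊔ (suc m) zero    = ≡.refl
fromSize-⊔ (suc m) (suc n) = ≡.cong just (ℕtoℚ-⊔ m n)

fromSize-mono-≤ : ∀ {m n} → m ≤ n → fromSize m ≤M fromSize n
fromSize-mono-≤ z≤n       = nothing≤
fromSize-mono-≤ (s≤s m≤n) = just≤ (ℕtoℚ-mono-≤ m≤n)

fromSize-cancel-≤ : ∀ {m n} → fromSize m ≤M fromSize n → m ≤ n
fromSize-cancel-≤ {zero}          _           = z≤n
fromSize-cancel-≤ {suc m} {suc n} (just≤ m≤n) = s≤s (ℕtoℚ-cancel-≤ m≤n)

fromSize-injective : ∀ {m n} → fromSize m ≡ fromSize n → m ≡ n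
fromSize-injective {m} eq = ≤-antisym (fromSize-cancel-≤ (≡.subst (fromSize m ≤M_) eq ≤M-refl))
                                      (fromSize-cancel-≤ (≡.subst (_≤M fromSize m) eq ≤M-refl))
  where
  ≤M-refl : fromSize m ≤M fromSize m
  ≤M-refl = fromSize-mono-≤ ≤-refl

maxℕ : (n : ℕ) → (Fin n → ℕ) → ℕ
maxℕ zero    f = 0
maxℕ (suc n) f = f Fin.zero ⊔ maxℕ n (λ a → f (Fin.suc a))

≤maxℕ : ∀ n f (a : Fin n) → f a ≤ maxℕ n f
≤maxℕ (suc n) f Fin.zero    = m≤m⊔n _ _
≤maxℕ (suc n) f (Fin.suc a) = ≤-trans (≤maxℕ n _ a) (m≤n⊔m _ _)

maxℕ-≡0 : ∀ n f → (∀ a → f a ≡ 0) → maxℕ n f ≡ 0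
maxℕ-≡0 zero    f f≡0 = ≡.refl
maxℕ-≡0 (suc n) f f≡0 = ≡.cong₂ _⊔_ (f≡0 Fin.zero) (maxℕ-≡0 n _ (λ a → f≡0 (Fin.suc a)))

maxℕ-single : ∀ n f (a : Fin n) → (∀ b → b ≢ a → f b ≡ 0) → maxℕ n f ≡ f a
maxℕ-single (suc n) f Fin.zero f≡0 =
  ≡.trans (≡.cong (f Fin.zero ⊔_) (maxℕ-≡0 n _ λ b → f≡0 (Fin.suc b) λ ())) (⊔-identityʳ _)
maxℕ-single (suc n) f (Fin.suc a) f≡0 =
  ≡.trans (≡.cong (_⊔ maxℕ n (f ∘ Fin.suc)) (f≡0 Fin.zero λ ()))
          (maxℕ-single n (f ∘ Fin.suc) a λ b b≢a → f≡0 (Fin.suc b) (b≢a ∘ Finₚ.suc-injective))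

module LinearSpan {c ℓ : Level} (F : FiniteField c ℓ) (X : Set) where
  open FiniteField F hiding (zero)
  open import Relation.Binary.Reasoning.Setoid setoid
  open import Algebra.Properties.Ring ring using (-‿distribˡ-*)
  open import Algebra.Properties.CommutativeSemigroup +-commutativeSemigroup using (interchange)

  Family : Set c
  Family = ℕ → X → Carrier

  Σ< : ℕ → (ℕ → Carrier) → Carrier
  Σ< = sumF F

  Σ<-cong : ∀ n {f g} → (∀ l → l < n → f l ≈ g l) → Σ< n f ≈ Σ< n g
  Σ<-cong zero    f≈g = refl
  Σ<-cong (suc n) f≈g = +-cong (Σ<-cong n λ l l<n → f≈g l (m<n⇒m<1+n l<n)) (f≈g n ≤-refl)

  Σ<-zero : ∀ n {f} → (∀ l → l < n → f l ≈ 0#) → Σ< n f ≈ 0#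
  Σ<-zero zero    f≈0 = refl
  Σ<-zero (suc n) f≈0 =
    trans (+-cong (Σ<-zero n λ l l<n → f≈0 l (m<n⇒m<1+n l<n)) (f≈0 n ≤-refl)) (+-identityˡ 0#)

  Σ<-+ : ∀ n f g → Σ< n (λ l → f l + g l) ≈ Σ< n f + Σ< n g
  Σ<-+ zero    f g = sym (+-identityˡ 0#)
  Σ<-+ (suc n) f g = trans (+-congʳ (Σ<-+ n f g)) (interchange _ _ _ _)

  Σ<-*ˡ : ∀ n a f → Σ< n (λ l → a * f l) ≈ a * Σ< n f
  Σ<-*ˡ zero    a f = sym (zeroʳ a)
  Σ<-*ˡ (suc n) a f = trans (+-congʳ (Σ<-*ˡ n a f)) (sym (distribˡ a _ _))

  Σ<-single : ∀ n {f} j → j < n → (∀ l → l < n → l ≢ j → f l ≈ 0#) → Σ< n f ≈ f j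
  Σ<-single (suc n) j j<1+n f≈0 with j ≟ℕ n
  ... | yes ≡.refl =
    trans (+-congʳ (Σ<-zero n λ l l<n → f≈0 l (m<n⇒m<1+n l<n) λ { ≡.refl → <-irrefl ≡.refl l<n }))
          (+-identityˡ _)
  ... | no j≢n =
    trans (+-cong (Σ<-single n j (≤∧≢⇒< (≤-pred j<1+n) j≢n) λ l l<n → f≈0 l (m<n⇒m<1+n l<n))
                  (f≈0 n ≤-refl (j≢n ∘ ≡.sym)))
          (+-identityʳ _)

  combination : ℕ → (ℕ → Carrier) → Family → X → Carrier
  combination n a v x = Σ< n (λ l → a l * v l x)

  Span : ℕ → Family → (X → Carrier) → Set (c Level.⊔ ℓ)
  Span n v w = ∃ λ a → ∀ x → w x ≈ combination n a v x

  combination-linear : ∀ n α β a b v x →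
    combination n (λ l → α * a l + β * b l) v x ≈ α * combination n a v x + β * combination n b v x
  combination-linear n α β a b v x = begin
    Σ< n (λ l → (α * a l + β * b l) * v l x)
      ≈⟨ Σ<-cong n (λ l _ → trans (distribʳ _ _ _) (+-cong (*-assoc _ _ _) (*-assoc _ _ _))) ⟩
    Σ< n (λ l → α * (a l * v l x) + β * (b l * v l x))
      ≈⟨ Σ<-+ n _ _ ⟩
    Σ< n (λ l → α * (a l * v l x)) + Σ< n (λ l → β * (b l * v l x))
      ≈⟨ +-cong (Σ<-*ˡ n α _) (Σ<-*ˡ n β _) ⟩
    α * combination n a v x + β * combination n b v x ∎

  combination-dropLast : ∀ n a v x → a n ≈ 0# → combination (suc n) a v x ≈ combination n a v x
  combination-dropLast n a v x aₙ≈0 = trans (+-congˡ (trans (*-congʳ aₙ≈0) (zeroˡ _))) (+-identityʳ _)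

  span-resp : ∀ n v {w w′} → (∀ x → w x ≈ w′ x) → Span n v w → Span n v w′
  span-resp n v w≈w′ (a , w≈) = a , λ x → trans (sym (w≈w′ x)) (w≈ x)

  span-zero : ∀ n v {w} → (∀ x → w x ≈ 0#) → Span n v w
  span-zero n v w≈0 = (λ _ → 0#) , λ x → trans (w≈0 x) (sym (Σ<-zero n λ l _ → zeroˡ _))

  span-linear : ∀ n v α β {w w′} → Span n v w → Span n v w′ → Span n v (λ x → α * w x + β * w′ x)
  span-linear n v α β (a , w≈) (b , w′≈) = (λ l → α * a l + β * b l) , λ x →
    trans (+-cong (*-congˡ (w≈ x)) (*-congˡ (w′≈ x))) (sym (combination-linear n α β a b v x))

  δ : ℕ → ℕ → Carrier
  δ j l with l ≟ℕ j
  ... | yes _ = 1#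
  ... | no  _ = 0#

  span-generator : ∀ n v j → j < n → Span n v (v j)
  span-generator n v j j<n = δ j , λ x → sym (trans (Σ<-single n j j<n (off x)) (on x))
    where
    off : ∀ x l → l < n → l ≢ j → δ j l * v l x ≈ 0#
    off x l _ l≢j with l ≟ℕ j
    ... | yes l≡j = ⊥-elim (l≢j l≡j)
    ... | no  _   = zeroˡ _
    on : ∀ x → δ j j * v j x ≈ v j x
    on x with j ≟ℕ j
    ... | yes _   = *-identityˡ _
    ... | no  j≢j = ⊥-elim (j≢j ≡.refl)

  span-combination : ∀ n m v u → (∀ j → j < m → Span n v (u j)) → ∀ a → Span n v (combination m a u)
  span-combination n zero    v u _      a = span-zero n v λ _ → refl
  span-combination n (suc m) v u u∈span a =
    span-resp n v (λ x → +-congʳ (*-identityˡ _))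
      (span-linear n v 1# (a m) (span-combination n m v u (λ j j<m → u∈span j (m<n⇒m<1+n j<m)) a)
                                (u∈span m ≤-refl))

  span-trans : ∀ n m v u {w} → (∀ j → j < m → Span n v (u j)) → Span m u w → Span n v w
  span-trans n m v u u∈span (a , w≈) = span-resp n v (sym ∘ w≈) (span-combination n m v u u∈span a)

  span-mono : ∀ {n n′} v {w} → n ≤ n′ → Span n v w → Span n′ v w
  span-mono {n} {n′} v n≤n′ = span-trans n′ n v v λ j j<n → span-generator n′ v j (<-≤-trans j<n n≤n′)

  span-cancel : ∀ n v α {w} → ¬ α ≈ 0# → Span n v (λ x → α * w x) → Span n v w
  span-cancel n v α {w} α≉0 αw∈span with inverse α α≉0
  ... | α⁻¹ , αα⁻¹≈1 =
    span-resp n v (λ x → trans (+-congˡ (zeroˡ _)) (trans (+-identityʳ _) (cancel x)))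
      (span-linear n v α⁻¹ 0# αw∈span αw∈span)
    where
    cancel : ∀ x → α⁻¹ * (α * w x) ≈ w x
    cancel x = trans (sym (*-assoc _ _ _)) (trans (*-congʳ (trans (*-comm _ _) αα⁻¹≈1)) (*-identityˡ _))

  least-nonzero : ∀ m (a : ℕ → Carrier) →
    (∀ l → l ≤ m → a l ≈ 0#) ⊎ ∃ λ p → p ≤ m × ¬ a p ≈ 0# × (∀ l → l < p → a l ≈ 0#)
  least-nonzero m a with a 0 ≟ 0#
  ... | no a₀≉0 = inj₂ (0 , z≤n , a₀≉0 , λ _ ())
  least-nonzero zero    a | yes a₀≈0 = inj₁ λ { zero _ → a₀≈0 }
  least-nonzero (suc m) a | yes a₀≈0 with least-nonzero m (λ l → a (suc l))
  ... | inj₁ zeros = inj₁ λ { zero _ → a₀≈0 ; (suc l) (s≤s l≤m) → zeros l l≤m }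
  ... | inj₂ (p , p≤m , aₚ≉0 , below) =
    inj₂ (suc p , s≤s p≤m , aₚ≉0 , λ { zero _ → a₀≈0 ; (suc l) (s≤s l<p) → below l l<p })

  Dependent : ℕ → Family → Set (c Level.⊔ ℓ)
  Dependent m v = ∃ λ l → l ≤ m × Span l v (v l)

  -- One step of Gaussian elimination on column n of the coefficient rows a l: row p (the first with a
  -- nonzero pivot) clears the pivots of the later rows and is then dropped. Rows of coefficients and the
  -- vectors they describe are reduced by the same formula, whence the type-generic reduce.
  module Elimination (a : ℕ → ℕ → Carrier) (n p : ℕ) where

    pivot : ℕ → Carrier
    pivot l = a l n

    reduce : {Y : Set} → (ℕ → Y → Carrier) → ℕ → Y → Carrier
    reduce f l y with l <? p
    ... | yes _ = f l y
    ... | no  _ = pivot p * f (suc l) y + (- pivot (suc l)) * f p y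

    reduce-below : ∀ {Y} (f : ℕ → Y → Carrier) {l} → l < p → ∀ y → reduce f l y ≈ f l y
    reduce-below f {l} l<p y with l <? p
    ... | yes _   = refl
    ... | no  l≮p = ⊥-elim (l≮p l<p)

    reduce-combination : ∀ N m v w → p ≤ suc m →
      (∀ l → l ≤ suc m → ∀ x → v l x ≈ combination N (a l) w x) →
      ∀ l → l ≤ m → ∀ x → reduce v l x ≈ combination N (reduce a l) w x
    reduce-combination N m v w p≤1+m v≈ l l≤m x with l <? p
    ... | yes _ = v≈ l (m≤n⇒m≤1+n l≤m) x
    ... | no  _ = begin
      pivot p * v (suc l) x + (- pivot (suc l)) * v p x
        ≈⟨ +-cong (*-congˡ (v≈ (suc l) (s≤s l≤m) x)) (*-congˡ (v≈ p p≤1+m x)) ⟩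
      pivot p * combination N (a (suc l)) w x + (- pivot (suc l)) * combination N (a p) w x
        ≈⟨ sym (combination-linear N _ _ (a (suc l)) (a p) w x) ⟩
      combination N (λ k → pivot p * a (suc l) k + (- pivot (suc l)) * a p k) w x ∎

    reduce-clears-pivots : (∀ l → l < p → pivot l ≈ 0#) → ∀ l → reduce a l n ≈ 0#
    reduce-clears-pivots below l with l <? p
    ... | yes l<p = below l l<p
    ... | no  _   = trans (+-congˡ (trans (sym (-‿distribˡ-* _ _)) (-‿cong (*-comm _ _)))) (-‿inverseʳ _)

    reduce-∈-span : ∀ v j → Span (suc (suc j)) v (reduce v j)
    reduce-∈-span v j with j <? p
    ... | yes _   = span-generator (suc (suc j)) v j (m<n⇒m<1+n ≤-refl)
    ... | no  j≮p = span-linear (suc (suc j)) v _ _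
                      (span-generator (suc (suc j)) v (suc j) ≤-refl)
                      (span-generator (suc (suc j)) v p (s≤s (m≤n⇒m≤1+n (≮⇒≥ j≮p))))

    reduce-dependent : ∀ {m} v → ¬ pivot p ≈ 0# → Dependent m (reduce v) → Dependent (suc m) v
    reduce-dependent v pivot≉0 (l , l≤m , uₗ∈span) with l <? p
    ... | yes l<p = l , m≤n⇒m≤1+n l≤m ,
      span-trans l l v (reduce v) (λ j j<l →
        span-resp l v (sym ∘ reduce-below v (<-trans j<l l<p)) (span-generator l v j j<l)) uₗ∈span
    ... | no  l≮p = suc l , s≤s l≤m , span-cancel (suc l) v (pivot p) pivot≉0
      (span-resp (suc l) v restore
        (span-linear (suc l) v 1# (pivot (suc l))
          (span-trans (suc l) l v (reduce v) (λ j j<l → span-mono v (s≤s j<l) (reduce-∈-span v j)) uₗ∈span)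
          (span-generator (suc l) v p (s≤s (≮⇒≥ l≮p)))))
      where
      restore : ∀ x → 1# * (pivot p * v (suc l) x + (- pivot (suc l)) * v p x) + pivot (suc l) * v p x
                      ≈ pivot p * v (suc l) x
      restore x = begin
        1# * (pivot p * v (suc l) x + (- pivot (suc l)) * v p x) + pivot (suc l) * v p x
          ≈⟨ +-congʳ (*-identityˡ _) ⟩
        pivot p * v (suc l) x + (- pivot (suc l)) * v p x + pivot (suc l) * v p x
          ≈⟨ +-assoc _ _ _ ⟩
        pivot p * v (suc l) x + ((- pivot (suc l)) * v p x + pivot (suc l) * v p x)
          ≈⟨ +-congˡ (trans (sym (distribʳ _ _ _)) (trans (*-congʳ (-‿inverseˡ _)) (zeroˡ _))) ⟩
        pivot p * v (suc l) x + 0#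
          ≈⟨ +-identityʳ _ ⟩
        pivot p * v (suc l) x ∎

  combinations⇒dependent : ∀ n m → n ≤ m → (v w : Family) (a : ℕ → ℕ → Carrier) →
    (∀ l → l ≤ m → ∀ x → v l x ≈ combination n (a l) w x) → Dependent m v
  combinations⇒dependent zero m _ v w a v≈ = 0 , z≤n , span-zero 0 v (v≈ 0 z≤n)
  combinations⇒dependent (suc n) (suc m) (s≤s n≤m) v w a v≈ with least-nonzero (suc m) (λ l → a l n)
  ... | inj₁ zeros =
    combinations⇒dependent n (suc m) (m≤n⇒m≤1+n n≤m) v w a λ l l≤1+m x →
      trans (v≈ l l≤1+m x) (combination-dropLast n (a l) w x (zeros l l≤1+m))
  ... | inj₂ (p , p≤1+m , pivot≉0 , zeros) =
    reduce-dependent v pivot≉0 (combinations⇒dependent n m n≤m (reduce v) w (reduce a) λ l l≤m x →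
      trans (reduce-combination (suc n) m v w p≤1+m v≈ l l≤m x)
            (combination-dropLast n (reduce a l) w x (reduce-clears-pivots zeros l)))
    where open Elimination a n p

  spannedByFewer⇒dependent : ∀ n m → n ≤ m → (v w : Family) →
    (∀ l → l ≤ m → Span n w (v l)) → Dependent m v
  spannedByFewer⇒dependent n m n≤m v w v∈span = combinations⇒dependent n m n≤m v w a v≈
    where
    a : ℕ → ℕ → Carrier
    a l with l ≤? m
    ... | yes l≤m = proj₁ (v∈span l l≤m)
    ... | no  _   = λ _ → 0#
    v≈ : ∀ l → l ≤ m → ∀ x → v l x ≈ combination n (a l) w x
    v≈ l l≤m with l ≤? m
    ... | yes l≤m′ = proj₂ (v∈span l l≤m′)
    ... | no  l≰m  = ⊥-elim (l≰m l≤m)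

module Polynomial {c ℓ : Level} (F : FiniteField c ℓ) where
  open FiniteField F hiding (zero)

  deg⁺ : Maybe ℕ → ℕ
  deg⁺ nothing  = 0
  deg⁺ (just d) = suc d

  deg⁺≤⇒coeff≈0 : ∀ as n → deg⁺ (deg F as) ≤ n → coeff F as n ≈ 0#
  deg⁺≤⇒coeff≈0 []       n _ = refl
  deg⁺≤⇒coeff≈0 (a ∷ as) n deg⁺≤n with deg F as in eq
  deg⁺≤⇒coeff≈0 (a ∷ as) (suc n) (s≤s deg⁺≤n) | just d =
    deg⁺≤⇒coeff≈0 as n (≡.subst (λ md → deg⁺ md ≤ n) (≡.sym eq) deg⁺≤n)
  deg⁺≤⇒coeff≈0 (a ∷ as) (suc n) _ | nothing =
    deg⁺≤⇒coeff≈0 as n (≡.subst (λ md → deg⁺ md ≤ n) (≡.sym eq) z≤n)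
  deg⁺≤⇒coeff≈0 (a ∷ as) zero _ | nothing with a ≟ 0#
  ... | yes a≈0 = a≈0
  deg⁺≤⇒coeff≈0 (a ∷ as) zero () | nothing | no _

  monomial : ℕ → Poly F
  monomial zero    = 1# ∷ []
  monomial (suc m) = 0# ∷ monomial m

  coeff-monomial-≡ : ∀ m → coeff F (monomial m) m ≈ 1#
  coeff-monomial-≡ zero    = refl
  coeff-monomial-≡ (suc m) = coeff-monomial-≡ m

  coeff-monomial-≢ : ∀ m n → n ≢ m → coeff F (monomial m) n ≈ 0#
  coeff-monomial-≢ zero    zero    n≢m = ⊥-elim (n≢m ≡.refl)
  coeff-monomial-≢ zero    (suc n) _   = refl
  coeff-monomial-≢ (suc m) zero    _   = refl
  coeff-monomial-≢ (suc m) (suc n) n≢m = coeff-monomial-≢ m n (n≢m ∘ ≡.cong suc)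

  deg-monomial : ∀ m → deg F (monomial m) ≡ just m
  deg-monomial zero with 1# ≟ 0#
  ... | yes 1≈0 = ⊥-elim (1≉0 1≈0)
  ... | no  _   = ≡.refl
  deg-monomial (suc m) rewrite deg-monomial m = ≡.refl

-- A monomial (a , n) stands for T^n eₐ; at the vertex n_s its log-norm is its level n + [a < s].
-- Listing the monomials by level and then by a, the first s slots (level 0, a < s) are empty, so the
-- monomial of rank j lies in slot j + s and has level ⌊(j + s)/r⌋.
module Enumeration (r : ℕ) .{{_ : NonZero r}} (s : ℕ) (s<r : s < r) where
  open import Data.Nat using (_+_; _*_; _/_)
  open import Data.Nat.Properties
  open import Data.Nat.DivMod
  open ≡
  open Modulo r
  open Finₚ using (toℕ<n; toℕ-fromℕ<; toℕ-injective)

  weight : Fin r → ℕ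
  weight a = if toℕ a <ᵇ s then 1 else 0

  weight-< : ∀ {a} → toℕ a < s → weight a ≡ 1
  weight-< {a} a<s with toℕ a <ᵇ s | <⇒<ᵇ a<s
  ... | true | _ = refl

  weight-≥ : ∀ {a} → ¬ toℕ a < s → weight a ≡ 0
  weight-≥ {a} a≮s with toℕ a <ᵇ s in eq
  ... | true  = ⊥-elim (a≮s (<ᵇ⇒< (toℕ a) s (subst T (sym eq) tt)))
  ... | false = refl

  Monomial : Set
  Monomial = Fin r × ℕ

  level : Monomial → ℕ
  level (a , n) = n + weight a

  levelAt : ℕ → ℕ
  levelAt j = (j + s) / r

  slot : Monomial → ℕ
  slot (a , n) = toℕ a + level (a , n) * r

  rank : Monomial → ℕ
  rank x = slot x ∸ s

  residueAt : ℕ → Fin r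
  residueAt j = fromℕ< (m%n<n (j + s) r)

  position : ℕ → Monomial
  position j = residueAt j , levelAt j ∸ weight (residueAt j)

  s≤slot : ∀ x → s ≤ slot x
  s≤slot (a , n) with toℕ a <? s
  ... | no  a≮s = ≤-trans (≮⇒≥ a≮s) (m≤m+n (toℕ a) _)
  ... | yes a<s = begin
    s                          ≤⟨ <⇒≤ s<r ⟩
    r                          ≤⟨ m≤n*m r (n + weight a) {{level≢0}} ⟩
    (n + weight a) * r         ≤⟨ m≤n+m _ (toℕ a) ⟩
    toℕ a + (n + weight a) * r ∎
    where
    open ≤-Reasoning
    level≢0 : NonZero (n + weight a)
    level≢0 rewrite weight-< a<s | +-comm n 1 = _

  rank+s≡slot : ∀ x → rank x + s ≡ slot x
  rank+s≡slot x = m∸n+n≡m (s≤slot x)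

  position-rank : ∀ x → position (rank x) ≡ x
  position-rank x@(a , n) =
    cong₂ _,_ residue (trans (cong₂ _∸_ level≡ (cong weight residue)) (m+n∸n≡m n (weight a)))
    where
    residue : residueAt (rank x) ≡ a
    residue = toℕ-injective (trans (toℕ-fromℕ< _)
                (trans (cong (_% r) (rank+s≡slot x)) ([m+kr]%r≡m (level x) (toℕ<n a))))
    level≡ : levelAt (rank x) ≡ level x
    level≡ = trans (cong (_/ r) (rank+s≡slot x)) ([m+kr]/r≡k (level x) (toℕ<n a))

  j+s≡residue+level : ∀ j → j + s ≡ toℕ (residueAt j) + levelAt j * r
  j+s≡residue+level j = trans (m≡m%n+[m/n]*n (j + s) r) (cong (_+ levelAt j * r) (sym (toℕ-fromℕ< _)))

  weight≤levelAt : ∀ j → weight (residueAt j) ≤ levelAt j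
  weight≤levelAt j with toℕ (residueAt j) <? s
  ... | no  a≮s rewrite weight-≥ a≮s = z≤n
  ... | yes a<s rewrite weight-< a<s = n≢0⇒n>0 λ levelAt≡0 → <⇒≱ a<s (begin
    s                                         ≤⟨ m≤n+m s j ⟩
    j + s                                     ≡⟨ j+s≡residue+level j ⟩
    toℕ (residueAt j) + levelAt j * r         ≡⟨ cong (λ t → toℕ (residueAt j) + t * r) levelAt≡0 ⟩
    toℕ (residueAt j) + 0                     ≡⟨ +-identityʳ _ ⟩
    toℕ (residueAt j)                         ∎)
    where open ≤-Reasoning

  level-position : ∀ j → level (position j) ≡ levelAt j
  level-position j = m∸n+n≡m (weight≤levelAt j)

  rank-position : ∀ j → rank (position j) ≡ j
  rank-position j = begin
    toℕ (residueAt j) + level (position j) * r ∸ s ≡⟨ cong (λ t → toℕ (residueAt j) + t * r ∸ s) (level-position j) ⟩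
    toℕ (residueAt j) + levelAt j * r ∸ s          ≡⟨ cong (_∸ s) (j+s≡residue+level j) ⟨
    j + s ∸ s                                      ≡⟨ m+n∸n≡m j s ⟩
    j                                              ∎
    where open ≡-Reasoning

  position≡⇒≡rank : ∀ {l x} → position l ≡ x → l ≡ rank x
  position≡⇒≡rank {l} eq = trans (sym (rank-position l)) (cong rank eq)

  position-injective : ∀ {j l} → position j ≡ position l → j ≡ l
  position-injective {l = l} eq = trans (position≡⇒≡rank eq) (rank-position l)

  rank-< : ∀ T x → level x < T → rank x < T * r ∸ s
  rank-< T x@(a , n) level<T = ∸-monoˡ-< (begin-strict
    toℕ a + level x * r   <⟨ +-monoˡ-< (level x * r) (toℕ<n a) ⟩
    r + level x * r       ≤⟨ *-monoˡ-≤ r level<T ⟩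
    T * r                 ∎) (s≤slot x)
    where open ≤-Reasoning

  levelAt-mono-≤ : ∀ {l j} → l ≤ j → levelAt l ≤ levelAt j
  levelAt-mono-≤ l≤j = /-monoˡ-≤ r (+-monoˡ-≤ s l≤j)

  levelAt*r∸s≤ : ∀ j → levelAt j * r ∸ s ≤ j
  levelAt*r∸s≤ j = ≤-trans (∸-monoˡ-≤ s (m/n*n≤m (j + s) r)) (≤-reflexive (m+n∸n≡m j s))

vertex∈chamber : ∀ r s → s < r → InChamber r (vertex r s)
vertex∈chamber (suc zero)    zero          _         = ≡.refl
vertex∈chamber (suc zero)    (suc s)       (s≤s ())
vertex∈chamber (suc (suc r)) zero          _         = ℚₚ.≤-refl , vertex∈chamber (suc r) zero z<s
vertex∈chamber (suc (suc r)) (suc zero)    _         = *≤* (+≤+ z≤n) , vertex∈chamber (suc r) zero z<s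
vertex∈chamber (suc (suc r)) (suc (suc s)) (s≤s s<r) = ℚₚ.≤-refl , vertex∈chamber (suc r) (suc s) s<r

module AtVertex {c ℓ : Level} (F : FiniteField c ℓ) (r : ℕ) .{{_ : NonZero r}} (s : ℕ) (s<r : s < r) where
  open import Data.Nat using (_+_; _*_)
  open FiniteField F
    using (Carrier; _≈_; 0#; 1#; 1≉0; refl; sym; trans; *-congˡ; zeroʳ; *-identityʳ)
    renaming (_*_ to _·_)
  open Enumeration r s s<r
  open LinearSpan F Monomial
  open Polynomial F

  coordinates : AVec F r → Monomial → Carrier
  coordinates w (a , n) = coeff F (w a) n

  InSpan⇒Span : ∀ j μ w → InSpan F j μ w → Span j (coordinates ∘ μ) (coordinates w)
  InSpan⇒Span j μ w (a , w≈) = a , λ (b , n) → w≈ b n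

  Span⇒InSpan : ∀ j μ w → Span j (coordinates ∘ μ) (coordinates w) → InSpan F j μ w
  Span⇒InSpan j μ w (a , w≈) = a , λ b n → w≈ (b , n)

  termSize : Maybe ℕ → ℕ → ℕ
  termSize nothing  _ = 0
  termSize (just d) e = suc (d + e)

  size : AVec F r → ℕ
  size w = maxℕ r (λ a → termSize (deg F (w a)) (weight a))

  vertex≡weight : ∀ a → vertex r s a ≡ ℕtoℚ (weight a)
  vertex≡weight a with toℕ a <ᵇ s
  ... | true  = ≡.refl
  ... | false = ≡.refl

  logNorm≡fromSize : ∀ w → logNorm F (vertex r s) w ≡ fromSize (size w)
  logNorm≡fromSize w = maxFin≡ r (λ a → termSize (deg F (w a)) (weight a)) (λ a → term≡ a (deg F (w a)))
    where
    term≡ : ∀ a md → termM F md (vertex r s a) ≡ fromSize (termSize md (weight a))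
    term≡ a nothing  = ≡.refl
    term≡ a (just d) = ≡.cong just (≡.trans (≡.cong (ℕtoℚ d ℚ.+_) (vertex≡weight a)) (ℕtoℚ-+ d (weight a)))
    maxFin≡ : ∀ n (f : Fin n → ℕ) {g} → (∀ a → g a ≡ fromSize (f a)) → maxFin F n g ≡ fromSize (maxℕ n f)
    maxFin≡ zero    f g≡ = ≡.refl
    maxFin≡ (suc n) f g≡ =
      ≡.trans (≡.cong₂ maxM (g≡ Fin.zero) (maxFin≡ n (f ∘ Fin.suc) (g≡ ∘ Fin.suc))) (fromSize-⊔ (f Fin.zero) _)

  size≤⇒vanishes : ∀ T w → size w ≤ T → ∀ x → T ≤ level x → coordinates w x ≈ 0#
  size≤⇒vanishes T w size≤T (a , n) T≤level =
    deg⁺≤⇒coeff≈0 (w a) n (termSize≤⇒deg⁺≤ (deg F (w a)) (≤-trans (≤maxℕ r _ a) (≤-trans size≤T T≤level)))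
    where
    termSize≤⇒deg⁺≤ : ∀ md → termSize md (weight a) ≤ n + weight a → deg⁺ md ≤ n
    termSize≤⇒deg⁺≤ nothing  _  = z≤n
    termSize≤⇒deg⁺≤ (just d) le = +-cancelʳ-≤ (weight a) (suc d) n le

  unit : Monomial → AVec F r
  unit (a , n) b with b Fin.≟ a
  ... | yes _ = monomial n
  ... | no  _ = []

  unit-at : ∀ a n → unit (a , n) a ≡ monomial n
  unit-at a n with a Fin.≟ a
  ... | yes _   = ≡.refl
  ... | no  a≢a = ⊥-elim (a≢a ≡.refl)

  unit-off : ∀ a n b → b ≢ a → unit (a , n) b ≡ []
  unit-off a n b b≢a with b Fin.≟ a
  ... | yes b≡a = ⊥-elim (b≢a b≡a)
  ... | no  _   = ≡.refl

  coordinates-unit-≡ : ∀ x → coordinates (unit x) x ≈ 1#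
  coordinates-unit-≡ (a , n) = ≡.subst (λ p → coeff F p n ≈ 1#) (≡.sym (unit-at a n)) (coeff-monomial-≡ n)

  coordinates-unit-≢ : ∀ x y → y ≢ x → coordinates (unit x) y ≈ 0#
  coordinates-unit-≢ (a , n) (b , m) y≢x with b Fin.≟ a
  ... | yes ≡.refl = coeff-monomial-≢ n m (y≢x ∘ ≡.cong (b ,_))
  ... | no  _      = refl

  size-unit : ∀ x → size (unit x) ≡ suc (level x)
  size-unit (a , n) = begin
    size (unit (a , n))                       ≡⟨ maxℕ-single r _ a (λ b → ≡.cong (termAt b) ∘ unit-off a n b) ⟩
    termAt a (unit (a , n) a)                 ≡⟨ ≡.cong (termAt a) (unit-at a n) ⟩
    termSize (deg F (monomial n)) (weight a)  ≡⟨ ≡.cong (λ md → termSize md (weight a)) (deg-monomial n) ⟩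
    suc (n + weight a)                        ∎
    where
    open ≡.≡-Reasoning
    termAt : Fin r → Poly F → ℕ
    termAt b p = termSize (deg F p) (weight b)

  basis : ℕ → AVec F r
  basis l = unit (position l)

  basisVector : Family
  basisVector l = coordinates (basis l)

  size-basis : ∀ l → size (basis l) ≡ suc (levelAt l)
  size-basis l = ≡.trans (size-unit (position l)) (≡.cong suc (level-position l))

  basisVector-off : ∀ l x → x ≢ position l → basisVector l x ≈ 0#
  basisVector-off l = coordinates-unit-≢ (position l)

  basis-independent : ∀ l → ¬ Span l basisVector (basisVector l)
  basis-independent l (a , βₗ≈) =
    1≉0 (trans (sym (coordinates-unit-≡ (position l)))
        (trans (βₗ≈ (position l))
               (Σ<-zero l λ k k<l → trans (*-congˡ (basisVector-off k (position l) λ eq →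
                                              <-irrefl (≡.sym (position-injective eq)) k<l))
                                          (zeroʳ _))))

  vanishing⇒∈basisSpan : ∀ T v → (∀ x → T ≤ level x → v x ≈ 0#) → Span (T * r ∸ s) basisVector v
  vanishing⇒∈basisSpan T v v≈0 = (v ∘ position) , expand
    where
    M = T * r ∸ s
    expand : ∀ x → v x ≈ combination M (v ∘ position) basisVector x
    expand x with rank x <? M
    ... | yes rank<M = sym (trans (Σ<-single M (rank x) rank<M off) on)
      where
      off : ∀ l → l < M → l ≢ rank x → v (position l) · basisVector l x ≈ 0#
      off l _ l≢rank = trans (*-congˡ (basisVector-off l x (l≢rank ∘ position≡⇒≡rank ∘ ≡.sym))) (zeroʳ _)
      on : v (position (rank x)) · basisVector (rank x) x ≈ v x
      on = ≡.subst (λ y → v y · coordinates (unit y) x ≈ v x) (≡.sym (position-rank x))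
                   (trans (*-congˡ (coordinates-unit-≡ x)) (*-identityʳ _))
    ... | no rank≮M = trans (v≈0 x (≮⇒≥ (rank≮M ∘ rank-< T x)))
      (sym (Σ<-zero M λ l l<M → trans (*-congˡ (basisVector-off l x λ x≡ →
                                         rank≮M (≡.subst (_< M) (position≡⇒≡rank (≡.sym x≡)) l<M)))
                                      (zeroʳ _)))

  size≤levelAt⇒∈basisSpan : ∀ j w → size w ≤ levelAt j → Span j basisVector (coordinates w)
  size≤levelAt⇒∈basisSpan j w size≤ = span-mono basisVector (levelAt*r∸s≤ j)
    (vanishing⇒∈basisSpan (levelAt j) _ (size≤⇒vanishes (levelAt j) w size≤))

  basis-isSuccMinBasis : IsSuccMinBasis F (vertex r s) basis
  basis-isSuccMinBasis j = basis-independent j ∘ InSpan⇒Span j basis (basis j) , minimal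
    where
    minimal : ∀ w → ¬ InSpan F j basis w → logNorm F (vertex r s) (basis j) ≤M logNorm F (vertex r s) w
    minimal w w∉span with suc (levelAt j) ≤? size w
    ... | yes βⱼ≤w = ≡.subst₂ _≤M_ (≡.sym (logNorm≡fromSize (basis j))) (≡.sym (logNorm≡fromSize w))
                       (fromSize-mono-≤ (≤-trans (≤-reflexive (size-basis j)) βⱼ≤w))
    ... | no  βⱼ≰w =
      ⊥-elim (w∉span (Span⇒InSpan j basis w (size≤levelAt⇒∈basisSpan j w (≤-pred (≰⇒> βⱼ≰w)))))

  module SuccessiveMinima (μ : ℕ → AVec F r) (μ-smb : IsSuccMinBasis F (vertex r s) μ) where

    μVector : Family
    μVector l = coordinates (μ l)

    μ-independent : ∀ l → ¬ Span l μVector (μVector l)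
    μ-independent l = proj₁ (μ-smb l) ∘ Span⇒InSpan l μ (μ l)

    size-minimal : ∀ j w → ¬ Span j μVector (coordinates w) → size (μ j) ≤ size w
    size-minimal j w w∉span = fromSize-cancel-≤ (≡.subst₂ _≤M_ (logNorm≡fromSize (μ j)) (logNorm≡fromSize w)
                                (proj₂ (μ-smb j) w (w∉span ∘ InSpan⇒Span j μ w)))

    size-mono : ∀ {l j} → l ≤ j → size (μ l) ≤ size (μ j)
    size-mono {l} {j} l≤j = size-minimal l (μ j) (μ-independent j ∘ span-mono μVector l≤j)

    levelAt<size : ∀ j → levelAt j < size (μ j)
    levelAt<size j = ≰⇒> λ size≤levelAt →
      let l , _ , μₗ∈span = spannedByFewer⇒dependent j j ≤-refl μVector basisVector λ l l≤j →
                              size≤levelAt⇒∈basisSpan j (μ l) (≤-trans (size-mono l≤j) size≤levelAt)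
      in μ-independent l μₗ∈span

    -- Minimality of μ j only bounds it against vectors outside the span of its predecessors, so it
    -- places each basis vector βₗ in that span only up to double negation.
    size≤1+levelAt : ∀ j → size (μ j) ≤ suc (levelAt j)
    size≤1+levelAt j = ≮⇒≥ λ levelAt<size → ¬¬-∀≤ j (βₗ∈span levelAt<size) λ β∈span →
      let l , _ , βₗ∈span = spannedByFewer⇒dependent j j ≤-refl basisVector μVector β∈span
      in basis-independent l βₗ∈span
      where
      βₗ∈span : suc (levelAt j) < size (μ j) → ∀ l → l ≤ j → ¬ ¬ Span j μVector (basisVector l)
      βₗ∈span levelAt<size l l≤j βₗ∉span = <⇒≱ levelAt<size (begin
        size (μ j)        ≤⟨ size-minimal j (basis l) βₗ∉span ⟩
        size (basis l)    ≡⟨ size-basis l ⟩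
        suc (levelAt l)   ≤⟨ s≤s (levelAt-mono-≤ l≤j) ⟩
        suc (levelAt j)   ∎)
        where open Data.Nat.Properties.≤-Reasoning

  size-succMinBasis : ∀ μ → IsSuccMinBasis F (vertex r s) μ → ∀ j → size (μ j) ≡ suc (levelAt j)
  size-succMinBasis μ μ-smb j = ≤-antisym (size≤1+levelAt j) (levelAt<size j)
    where open SuccessiveMinima μ μ-smb

  inseparable⇔ : ∀ k → Inseparable F k (vertex r s) ⇔ levelAt (pred k) ≡ levelAt k
  inseparable⇔ k = mk⇔ to from
    where
    open ≡.≡-Reasoning
    to : Inseparable F k (vertex r s) → levelAt (pred k) ≡ levelAt k
    to (μ , μ-smb , eq) = suc-injective (begin
      suc (levelAt (pred k))  ≡⟨ size-succMinBasis μ μ-smb (pred k) ⟨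
      size (μ (pred k))       ≡⟨ fromSize-injective (begin
        fromSize (size (μ (pred k)))          ≡⟨ logNorm≡fromSize (μ (pred k)) ⟨
        logNorm F (vertex r s) (μ (pred k))   ≡⟨ eq ⟩
        logNorm F (vertex r s) (μ k)          ≡⟨ logNorm≡fromSize (μ k) ⟩
        fromSize (size (μ k))                 ∎) ⟩
      size (μ k)              ≡⟨ size-succMinBasis μ μ-smb k ⟩
      suc (levelAt k)         ∎)
    from : levelAt (pred k) ≡ levelAt k → Inseparable F k (vertex r s)
    from eq = basis , basis-isSuccMinBasis , (begin
      logNorm F (vertex r s) (basis (pred k))   ≡⟨ logNorm≡fromSize (basis (pred k)) ⟩
      fromSize (size (basis (pred k)))          ≡⟨ ≡.cong fromSize (size-basis (pred k)) ⟩
      fromSize (suc (levelAt (pred k)))         ≡⟨ ≡.cong (fromSize ∘ suc) eq ⟩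
      fromSize (suc (levelAt k))                ≡⟨ ≡.cong fromSize (size-basis k) ⟨
      fromSize (size (basis k))                 ≡⟨ logNorm≡fromSize (basis k) ⟨
      logNorm F (vertex r s) (basis k)          ∎)

module _ {c ℓ : Level} (F : FiniteField c ℓ) (r : ℕ) .{{_ : NonZero r}} where
  open Modulo r
  open Finₚ using (toℕ<n; toℕ-fromℕ<; toℕ-injective)

  vertex∈W⇔ : ∀ k → 1 ≤ k → (j : Fin r) → InW F r k (vertex r (toℕ j)) ⇔ (¬ (k % r ≡ (r ∸ toℕ j) % r))
  vertex∈W⇔ k@(suc K) _ j =
    ⇔.trans InW⇔Inseparable (⇔.trans (inseparable⇔ k) ([m+n]/r≡[1+m+n]/r⇔ K (<⇒≤ s<r)))
    where
    s = toℕ j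
    s<r = toℕ<n j
    open AtVertex F r s s<r
    InW⇔Inseparable : InW F r k (vertex r s) ⇔ Inseparable F k (vertex r s)
    InW⇔Inseparable = mk⇔ proj₂ (lift (vertex∈chamber r s s<r) ,_)

  residue-exists : ∀ k → ∃ λ (j : Fin r) → k % r ≡ (r ∸ toℕ j) % r
  residue-exists k = j , Equivalence.to ([m+n]%r≡0⇔ k (<⇒≤ (toℕ<n j)))
                           (≡.trans (≡.cong (λ t → (k ℕ.+ t) % r) (toℕ-fromℕ< _)) ([m+[r∸m%r]%r]%r≡0 k))
    where
    j = fromℕ< (m%n<n (r ∸ k % r) r)

  residue-unique : ∀ k {i j : Fin r} → k % r ≡ (r ∸ toℕ i) % r → k % r ≡ (r ∸ toℕ j) % r → i ≡ j
  residue-unique k {i} {j} k≡i k≡j = toℕ-injective ([m+i]%r≡0-unique k (toℕ<n i) (toℕ<n j)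
    (Equivalence.from ([m+n]%r≡0⇔ k (<⇒≤ (toℕ<n i))) k≡i)
    (Equivalence.from ([m+n]%r≡0⇔ k (<⇒≤ (toℕ<n j))) k≡j))

proposition2p11 : {c ℓ : Level} (F : FiniteField c ℓ) (r : ℕ) .{{_ : NonZero r}} →
    2 ≤ r → (k : ℕ) → 1 ≤ k → (i : Fin r) →
    (InW F r k (vertex r (toℕ i)) ⇔ (¬ (k % r ≡ (r ∸ toℕ i) % r)))
    × ((∀ (j : Fin r) → j ≢ i → InW F r k (vertex r (toℕ j)))
        ⇔ (k % r ≡ (r ∸ toℕ i) % r))
proposition2p11 F r _ k 1≤k i =
  vertex∈W⇔ F r k 1≤k i ,
  everywhereBut⇔ (vertex∈W⇔ F r k 1≤k) (residue-exists F r k) (residue-unique F r k) i
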